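{- Let $G$ be a $(C_4,C_4)$-dumbbell. Then $G$ admits a $(7,3)$-configuration.
   Context: A path in $G$ is binary if all its internal vertices have degree $2$ in $G$. For graphs $H_1,H_2$ with at most one common vertex, $G$ is an $(H_1,H_2)$-dumbbell if $G$ is the union of $H_1$, $H_2$ and a path $P$ such that: (1) $P$ is a binary path in $G$ with $|V(P)|\ge1$; (2) for each $i$, $V(H_i)\cap V(P)$ is a single vertex, an end-vertex of $P$; (3) if $|V(P)|\ge 2$ then $H_1,H_2$ are vertex disjoint. Here $C_4$ is the $4$-cycle. A set is dominating if every vertex outside it has a neighbour in it; a $(k,s)$-configuration is a multiset of $k$ dominating sets such that every vertex lies in at most $s$ of them. -}

module Defs where

open import Data.Nat using (ℕ; suc; _≤_)
open import Data.Bool using (Bool; true; false)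
open import Data.Fin using (Fin; zero; suc; inject₁; fromℕ)
open import Data.Fin.Subset using (Subset; _∈_; _∉_; ∣_∣; inside; outside)
open import Data.Vec using (tabulate; lookup)
open import Data.Product using (Σ; ∃; _×_; _,_)
open import Data.Sum using (_⊎_)
open import Relation.Binary.PropositionalEquality using (_≡_; _≢_)
open import Relation.Nullary using (¬_)
open import Function using (_⇔_)
open import Function.Definitions using (Injective)

record Graph (n : ℕ) : Set where
  field
    adj      : Fin n → Fin n → Bool
    adj-sym  : ∀ x y → adj x y ≡ adj y x
    adj-irr  : ∀ x → adj x x ≡ false

open Graph public

Adj : ∀ {n} → Graph n → Fin n → Fin n → Set
Adj G x y = adj G x y ≡ true

N : ∀ {n} → Graph n → Fin n → Subset n
N G v = tabulate (λ u → if-adj (adj G v u))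
  where
  if-adj : Bool → Bool
  if-adj true  = inside
  if-adj false = outside

deg : ∀ {n} → Graph n → Fin n → ℕ
deg G v = ∣ N G v ∣

SameEdge : ∀ {n} → Fin n → Fin n → Fin n → Fin n → Set
SameEdge x y a b = (x ≡ a × y ≡ b) ⊎ (x ≡ b × y ≡ a)

next4 : Fin 4 → Fin 4
next4 zero = suc zero
next4 (suc zero) = suc (suc zero)
next4 (suc (suc zero)) = suc (suc (suc zero))
next4 (suc (suc (suc zero))) = zero

-- A 4-cycle given by an injective labelling c : Fin 4 → Fin n of its vertices;
-- its vertex set is the image of c, its edges are {c j , c (j+1 mod 4)}.
InC4 : ∀ {n} → (Fin 4 → Fin n) → Fin n → Set
InC4 c x = ∃ λ j → c j ≡ x

EdgeC4 : ∀ {n} → (Fin 4 → Fin n) → Fin n → Fin n → Set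
EdgeC4 c x y = ∃ λ j → SameEdge x y (c j) (c (next4 j))

-- A path with k+1 vertices p 0, …, p k (injective labelling);
-- edges are {p i , p (i+1)}.
InPath : ∀ {n k} → (Fin (suc k) → Fin n) → Fin n → Set
InPath p x = ∃ λ i → p i ≡ x

EdgePath : ∀ {n k} → (Fin (suc k) → Fin n) → Fin n → Fin n → Set
EdgePath {k = k} p x y = ∃ λ (i : Fin k) → SameEdge x y (p (inject₁ i)) (p (suc i))

IsEnd : ∀ {n k} → (Fin (suc k) → Fin n) → Fin n → Set
IsEnd {k = k} p v = v ≡ p zero ⊎ v ≡ p (fromℕ k)

record C4C4Dumbbell {n : ℕ} (G : Graph n) : Set where
  field
    c₁ c₂ : Fin 4 → Fin n
    k     : ℕ
    p     : Fin (suc k) → Fin n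
    c₁-inj : Injective _≡_ _≡_ c₁
    c₂-inj : Injective _≡_ _≡_ c₂
    p-inj  : Injective _≡_ _≡_ p
    c₁-sub : ∀ j → Adj G (c₁ j) (c₁ (next4 j))
    c₂-sub : ∀ j → Adj G (c₂ j) (c₂ (next4 j))
    p-sub  : ∀ (i : Fin k) → Adj G (p (inject₁ i)) (p (suc i))
    vert-union : ∀ x → InC4 c₁ x ⊎ InC4 c₂ x ⊎ InPath p x
    edge-union : ∀ x y → Adj G x y → EdgeC4 c₁ x y ⊎ EdgeC4 c₂ x y ⊎ EdgePath p x y
    common≤1 : ∀ x y → InC4 c₁ x → InC4 c₂ x → InC4 c₁ y → InC4 c₂ y → x ≡ y
    binary : ∀ (i : Fin (suc k)) → i ≢ zero → i ≢ fromℕ k → deg G (p i) ≡ 2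
    meet₁ : ∃ λ v → IsEnd p v × (∀ x → (InC4 c₁ x × InPath p x) ⇔ (x ≡ v))
    meet₂ : ∃ λ v → IsEnd p v × (∀ x → (InC4 c₂ x × InPath p x) ⇔ (x ≡ v))
    disjoint : 1 ≤ k → ∀ x → InC4 c₁ x → ¬ InC4 c₂ x

Dominating : ∀ {n} → Graph n → Subset n → Set
Dominating G D = ∀ v → v ∉ D → ∃ λ u → u ∈ D × Adj G v u

-- a (k,s)-configuration: k dominating sets (a multiset, indexed by Fin k),
-- each vertex lying in at most s of them
Configuration : ∀ {n} → Graph n → ℕ → ℕ → Set
Configuration {n} G k s =
  Σ (Fin k → Subset n) λ D →
    (∀ i → Dominating G (D i)) ×
    (∀ v → ∣ tabulate (λ i → lookup (D i) v) ∣ ≤ s)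

-- Give every vertex the set of dominating sets containing it: a (7,3)-configuration is the
-- same as a labelling of the vertices by at most three of the colours 0,…,6 such that every
-- closed neighbourhood sees all seven colours.  Label the path vertex p t by the three
-- consecutive colours {-3t, 1-3t, 2-3t} (mod 7): three consecutive path labels are nine
-- consecutive residues, so interior path vertices are fine.  Each 4-cycle is completed by a
-- fixed table of triples, chosen once for the cycle at p 0 and once for the cycle at p k;
-- the latter is transported to position k by the colour rotation c ↦ c - 3k, which preserves
-- unions and sizes.  When k = 0 the two cycles share their anchor and a third table is used.
-- Extra edges of G only help, so only the spanning dumbbell is used.
module Submission where

open import Defs
open import Data.Nat using (ℕ; zero; suc; _*_; _≤_) renaming (_≟_ to _≟ℕ_)
open import Data.Nat.Properties using (≤-reflexive; n≢0⇒n>0)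
open import Data.Nat.GeneralisedArithmetic using (iterate)
open import Data.Bool using (_∨_)
open import Data.Fin using (Fin; zero; suc; toℕ; fromℕ; inject₁; #_)
open import Data.Fin.Properties using (toℕ-injective; toℕ-fromℕ; toℕ-inject₁; all?; any?)
  renaming (_≟_ to _≟ᶠ_)
open import Data.Fin.Subset using (Subset; _∈_; ∣_∣; ⊤; ⁅_⁆; _∪_; ⋃; inside; outside)
open import Data.Fin.Subset.Properties using (∈⊤; ∉⊥; x∈p∪q⁻)
open import Data.Vec using (Vec; []; _∷_; _∷ʳ_; replicate; zipWith; tabulate; lookup)
open import Data.Vec.Properties
  using (lookup⇒[]=; []=⇒lookup; lookup∘tabulate; tabulate∘lookup; tabulate-cong)
open import Data.List using (List; []; _∷_; map)
open import Data.List.Properties using (map-id; map-∘; map-cong)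
open import Data.List.Relation.Unary.All using (All; []; _∷_)
open import Data.List.Relation.Unary.All.Properties using (map⁺)
open import Data.Product using (∃; ∃₂; _×_; _,_; proj₁; proj₂)
open import Data.Sum using (_⊎_; inj₁; inj₂; [_,_]′) renaming (map to ⊎-map)
open import Data.Empty using (⊥-elim)
open import Relation.Nullary using (yes; no)
open import Relation.Nullary.Decidable using (from-yes; _→-dec_)
open import Relation.Binary.PropositionalEquality
  using (_≡_; refl; sym; trans; cong; cong₂; subst; module ≡-Reasoning)
open import Function using (_∘_; id)
open import Function.Bundles using (Equivalence)
open import Function.Definitions using (Injective)

Adj-sym : ∀ {n} (G : Graph n) {x y} → Adj G x y → Adj G y x
Adj-sym G {x} {y} x∼y = trans (adj-sym G y x) x∼y

FullNbhd : ∀ {n k} → Graph n → (Fin n → Subset k) → Fin n → Set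
FullNbhd G L v = ∀ c → c ∈ L v ⊎ ∃ λ u → Adj G v u × c ∈ L u

configuration-from-colouring : ∀ {n k s} {G : Graph n} (L : Fin n → Subset k) →
  (∀ v → ∣ L v ∣ ≤ s) → (∀ v → FullNbhd G L v) → Configuration G k s
configuration-from-colouring {G = G} L small full =
  D , dominating , λ v → subst (λ S → ∣ S ∣ ≤ _) (sym (column v)) (small v)
  where
  D : Fin _ → Subset _
  D c = tabulate (λ v → lookup (L v) c)

  ∈D : ∀ {c v} → c ∈ L v → v ∈ D c
  ∈D {c} {v} c∈Lv = lookup⇒[]= v (D c) (trans (lookup∘tabulate _ v) ([]=⇒lookup c∈Lv))

  dominating : ∀ c → Dominating G (D c)
  dominating c v v∉Dc with full v c
  ... | inj₁ c∈Lv              = ⊥-elim (v∉Dc (∈D c∈Lv))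
  ... | inj₂ (u , v∼u , c∈Lu)  = u , ∈D c∈Lu , v∼u

  column : ∀ v → tabulate (λ c → lookup (D c) v) ≡ L v
  column v = trans (tabulate-cong (λ c → lookup∘tabulate _ v)) (tabulate∘lookup (L v))

full-from-⋃ : ∀ {n k} {G : Graph n} (L : Fin n → Subset k) {v} (us : List (Fin n)) →
  All (Adj G v) us → ⋃ (L v ∷ map L us) ≡ ⊤ → FullNbhd G L v
full-from-⋃ {G = G} L {v} us v∼us ⋃≡⊤ c with x∈p∪q⁻ (L v) _ (subst (c ∈_) (sym ⋃≡⊤) ∈⊤)
... | inj₁ c∈Lv = inj₁ c∈Lv
... | inj₂ c∈⋃  = inj₂ (neighbour us v∼us c∈⋃)
  where
  neighbour : ∀ us → All (Adj G v) us → c ∈ ⋃ (map L us) → ∃ λ u → Adj G v u × c ∈ L u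
  neighbour []       []           c∈⊥ = ⊥-elim (∉⊥ c∈⊥)
  neighbour (u ∷ us) (v∼u ∷ v∼us) c∈  with x∈p∪q⁻ (L u) _ c∈
  ... | inj₁ c∈Lu   = u , v∼u , c∈Lu
  ... | inj₂ c∈rest = neighbour us v∼us c∈rest

module Located {n k} (G : Graph n) {Loc : Set} (at : Loc → Fin n) (row : Loc → Subset k)
  (locate : ∀ x → ∃ λ ℓ → at ℓ ≡ x)
  (row-wd : ∀ ℓ ℓ′ → at ℓ ≡ at ℓ′ → row ℓ ≡ row ℓ′)
  where

  colour : Fin n → Subset k
  colour x = row (proj₁ (locate x))

  colour-at : ∀ ℓ → colour (at ℓ) ≡ row ℓ
  colour-at ℓ = row-wd _ ℓ (proj₂ (locate (at ℓ)))

  full-at : ∀ ℓ (ℓs : List Loc) → All (λ ℓ′ → Adj G (at ℓ) (at ℓ′)) ℓs →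
            ⋃ (row ℓ ∷ map row ℓs) ≡ ⊤ → FullNbhd G colour (at ℓ)
  full-at ℓ ℓs adjs ⋃≡⊤ =
    full-from-⋃ {G = G} colour (map at ℓs) (map⁺ adjs)
      (trans (cong ⋃ (cong₂ _∷_ (colour-at ℓ) colours)) ⋃≡⊤)
    where
    colours : map colour (map at ℓs) ≡ map row ℓs
    colours = trans (sym (map-∘ ℓs)) (map-cong colour-at ℓs)

  configuration : ∀ {s} → (∀ ℓ → ∣ row ℓ ∣ ≤ s) → (∀ ℓ → FullNbhd G colour (at ℓ)) →
                  Configuration G k s
  configuration small full = configuration-from-colouring {G = G} colour
    (λ x → small (proj₁ (locate x)))
    (λ x → subst (FullNbhd G colour) (proj₂ (locate x)) (full (proj₁ (locate x))))

rotate : ∀ {A : Set} {n} → Vec A (suc n) → Vec A (suc n)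
rotate (x ∷ xs) = xs ∷ʳ x

zipWith-∷ʳ : ∀ {A B C : Set} {n} (f : A → B → C) {x y} (xs : Vec A n) (ys : Vec B n) →
             zipWith f (xs ∷ʳ x) (ys ∷ʳ y) ≡ zipWith f xs ys ∷ʳ f x y
zipWith-∷ʳ f []       []       = refl
zipWith-∷ʳ f (x ∷ xs) (y ∷ ys) = cong (f x y ∷_) (zipWith-∷ʳ f xs ys)

replicate-∷ʳ : ∀ {A : Set} n (x : A) → replicate n x ∷ʳ x ≡ replicate (suc n) x
replicate-∷ʳ zero    x = refl
replicate-∷ʳ (suc n) x = cong (x ∷_) (replicate-∷ʳ n x)

∣∷ʳ∣ : ∀ {n} x (p : Subset n) → ∣ p ∷ʳ x ∣ ≡ ∣ x ∷ p ∣
∣∷ʳ∣ x       []            = refl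
∣∷ʳ∣ inside  (inside  ∷ p) = cong suc (∣∷ʳ∣ inside p)
∣∷ʳ∣ outside (inside  ∷ p) = cong suc (∣∷ʳ∣ outside p)
∣∷ʳ∣ inside  (outside ∷ p) = ∣∷ʳ∣ inside p
∣∷ʳ∣ outside (outside ∷ p) = ∣∷ʳ∣ outside p

rotate-∪ : ∀ {n} (p q : Subset (suc n)) → rotate (p ∪ q) ≡ rotate p ∪ rotate q
rotate-∪ (x ∷ p) (y ∷ q) = sym (zipWith-∷ʳ _∨_ p q)

rotate-⋃ : ∀ {n} (Ss : List (Subset (suc n))) → rotate (⋃ Ss) ≡ ⋃ (map rotate Ss)
rotate-⋃ {n} []       = replicate-∷ʳ n outside
rotate-⋃     (S ∷ Ss) = trans (rotate-∪ S (⋃ Ss)) (cong (rotate S ∪_) (rotate-⋃ Ss))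

rotate^ : ∀ {n} → ℕ → Subset (suc n) → Subset (suc n)
rotate^ r S = iterate rotate S r

rotate^-⋃ : ∀ {n} r (Ss : List (Subset (suc n))) → rotate^ r (⋃ Ss) ≡ ⋃ (map (rotate^ r) Ss)
rotate^-⋃ zero    Ss = cong ⋃ (sym (map-id Ss))
rotate^-⋃ (suc r) Ss = begin
  rotate^ r (rotate (⋃ Ss))            ≡⟨ cong (rotate^ r) (rotate-⋃ Ss) ⟩
  rotate^ r (⋃ (map rotate Ss))        ≡⟨ rotate^-⋃ r (map rotate Ss) ⟩
  ⋃ (map (rotate^ r) (map rotate Ss))  ≡⟨ cong ⋃ (sym (map-∘ Ss)) ⟩
  ⋃ (map (rotate^ (suc r)) Ss)         ∎
  where open ≡-Reasoning

rotate^-⊤ : ∀ {n} r → rotate^ {n} r ⊤ ≡ ⊤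
rotate^-⊤ {n} zero    = refl
rotate^-⊤ {n} (suc r) = trans (cong (rotate^ r) (replicate-∷ʳ n inside)) (rotate^-⊤ r)

∣rotate^∣ : ∀ {n} r (S : Subset (suc n)) → ∣ rotate^ r S ∣ ≡ ∣ S ∣
∣rotate^∣ zero    S       = refl
∣rotate^∣ (suc r) (x ∷ p) = trans (∣rotate^∣ r (p ∷ʳ x)) (∣∷ʳ∣ x p)

rotate^-full : ∀ {n} r (Ss : List (Subset (suc n))) → ⋃ Ss ≡ ⊤ → ⋃ (map (rotate^ r) Ss) ≡ ⊤
rotate^-full r Ss ⋃≡⊤ =
  trans (sym (rotate^-⋃ r Ss)) (trans (cong (rotate^ r) ⋃≡⊤) (rotate^-⊤ r))

prev4 : Fin 4 → Fin 4
prev4 zero                   = suc (suc (suc zero))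
prev4 (suc zero)             = zero
prev4 (suc (suc zero))       = suc zero
prev4 (suc (suc (suc zero))) = suc (suc zero)

next4-prev4 : ∀ j → next4 (prev4 j) ≡ j
next4-prev4 zero                   = refl
next4-prev4 (suc zero)             = refl
next4-prev4 (suc (suc zero))       = refl
next4-prev4 (suc (suc (suc zero))) = refl

next4⁴ : ∀ j → next4 (next4 (next4 (next4 j))) ≡ j
next4⁴ zero                   = refl
next4⁴ (suc zero)             = refl
next4⁴ (suc (suc zero))       = refl
next4⁴ (suc (suc (suc zero))) = refl

rotate4 : Fin 4 → Fin 4 → Fin 4
rotate4 j₀ j = iterate next4 j₀ (toℕ j)

rotate4-next : ∀ j₀ j → rotate4 j₀ (next4 j) ≡ next4 (rotate4 j₀ j)
rotate4-next j₀ zero                   = refl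
rotate4-next j₀ (suc zero)             = refl
rotate4-next j₀ (suc (suc zero))       = refl
rotate4-next j₀ (suc (suc (suc zero))) = sym (next4⁴ j₀)

rotate4-injective : ∀ j₀ → Injective _≡_ _≡_ (rotate4 j₀)
rotate4-injective j₀ {j} {j′} = from-yes
  (all? λ j₀ → all? λ j → all? λ j′ → (rotate4 j₀ j ≟ᶠ rotate4 j₀ j′) →-dec (j ≟ᶠ j′)) j₀ j j′

rotate4-surjective : ∀ j₀ j → ∃ λ j′ → rotate4 j₀ j′ ≡ j
rotate4-surjective = from-yes (all? λ j₀ → all? λ j → any? λ j′ → rotate4 j₀ j′ ≟ᶠ j)

module _ {n} {c : Fin 4 → Fin n} where

  sub-prev : (G : Graph n) → (∀ j → Adj G (c j) (c (next4 j))) → ∀ j → Adj G (c j) (c (prev4 j))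
  sub-prev G sub j =
    Adj-sym G (subst (λ t → Adj G (c (prev4 j)) (c t)) (next4-prev4 j) (sub (prev4 j)))

  sub-rotate4 : (G : Graph n) (j₀ : Fin 4) → (∀ j → Adj G (c j) (c (next4 j))) →
                ∀ j → Adj G (c (rotate4 j₀ j)) (c (rotate4 j₀ (next4 j)))
  sub-rotate4 G j₀ sub j =
    subst (λ t → Adj G (c (rotate4 j₀ j)) (c t)) (sym (rotate4-next j₀ j)) (sub (rotate4 j₀ j))

  InC4-rotate4⁺ : ∀ j₀ {x} → InC4 c x → InC4 (c ∘ rotate4 j₀) x
  InC4-rotate4⁺ j₀ (j , cj≡x) with rotate4-surjective j₀ j
  ... | j′ , e = j′ , trans (cong c e) cj≡x

  InC4-rotate4⁻ : ∀ j₀ {x} → InC4 (c ∘ rotate4 j₀) x → InC4 c x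
  InC4-rotate4⁻ j₀ (j , e) = rotate4 j₀ j , e

record OrientedDumbbell {n} (G : Graph n) (k : ℕ) (j₁ j₂ : Fin 4) : Set where
  field
    a b        : Fin 4 → Fin n
    p          : Fin (suc k) → Fin n
    a-inj      : Injective _≡_ _≡_ a
    b-inj      : Injective _≡_ _≡_ b
    p-inj      : Injective _≡_ _≡_ p
    a-sub      : ∀ j → Adj G (a j) (a (next4 j))
    b-sub      : ∀ j → Adj G (b j) (b (next4 j))
    p-sub      : ∀ (i : Fin k) → Adj G (p (inject₁ i)) (p (suc i))
    vert-union : ∀ x → InC4 a x ⊎ InC4 b x ⊎ InPath p x
    a-anchor   : a j₁ ≡ p zero
    b-anchor   : b j₂ ≡ p (fromℕ k)
    a∩p        : ∀ x → InC4 a x → InPath p x → x ≡ p zero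
    b∩p        : ∀ x → InC4 b x → InPath p x → x ≡ p (fromℕ k)
    a∩b        : ∀ x → InC4 a x → InC4 b x → x ≡ p zero

reorient : ∀ {n} {G : Graph n} {k j₁ j₂} → OrientedDumbbell G k j₁ j₂ → OrientedDumbbell G k zero zero
reorient {G = G} {j₁ = j₁} {j₂} D = record
  { a          = a ∘ rotate4 j₁
  ; b          = b ∘ rotate4 j₂
  ; p          = p
  ; a-inj      = rotate4-injective j₁ ∘ a-inj
  ; b-inj      = rotate4-injective j₂ ∘ b-inj
  ; p-inj      = p-inj
  ; a-sub      = sub-rotate4 G j₁ a-sub
  ; b-sub      = sub-rotate4 G j₂ b-sub
  ; p-sub      = p-sub
  ; vert-union = ⊎-map (InC4-rotate4⁺ j₁) (⊎-map (InC4-rotate4⁺ j₂) id) ∘ vert-union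
  ; a-anchor   = a-anchor
  ; b-anchor   = b-anchor
  ; a∩p        = λ x x∈a → a∩p x (InC4-rotate4⁻ j₁ x∈a)
  ; b∩p        = λ x x∈b → b∩p x (InC4-rotate4⁻ j₂ x∈b)
  ; a∩b        = λ x x∈a x∈b → a∩b x (InC4-rotate4⁻ j₁ x∈a) (InC4-rotate4⁻ j₂ x∈b)
  }
  where open OrientedDumbbell D

swap₁₂ : ∀ {A B C : Set} → A ⊎ B ⊎ C → B ⊎ A ⊎ C
swap₁₂ = [ inj₂ ∘ inj₁ , [ inj₁ , inj₂ ∘ inj₂ ]′ ]′

swap : ∀ {n} {G : Graph n} → C4C4Dumbbell G → C4C4Dumbbell G
swap D = record
  { c₁ = c₂ ; c₂ = c₁ ; k = k ; p = p
  ; c₁-inj = c₂-inj ; c₂-inj = c₁-inj ; p-inj = p-inj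
  ; c₁-sub = c₂-sub ; c₂-sub = c₁-sub ; p-sub = p-sub
  ; vert-union = swap₁₂ ∘ vert-union
  ; edge-union = λ x y x∼y → swap₁₂ (edge-union x y x∼y)
  ; common≤1   = λ x y x∈c₂ x∈c₁ y∈c₂ y∈c₁ → common≤1 x y x∈c₁ x∈c₂ y∈c₁ y∈c₂
  ; binary     = binary
  ; meet₁ = meet₂ ; meet₂ = meet₁
  ; disjoint   = λ 1≤k x x∈c₂ x∈c₁ → disjoint 1≤k x x∈c₁ x∈c₂
  }
  where open C4C4Dumbbell D

fromℕ≡zero : ∀ {k} → k ≡ 0 → fromℕ k ≡ zero
fromℕ≡zero {k} k≡0 = toℕ-injective (trans (toℕ-fromℕ k) k≡0)

module _ {n} {G : Graph n} (D : C4C4Dumbbell G) where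
  open C4C4Dumbbell D

  private
    v₁ v₂ : Fin n
    v₁ = proj₁ meet₁
    v₂ = proj₁ meet₂

    v₁∈c₁ : InC4 c₁ v₁
    v₁∈c₁ = proj₁ (Equivalence.from (proj₂ (proj₂ meet₁) v₁) refl)

    v₂∈c₂ : InC4 c₂ v₂
    v₂∈c₂ = proj₁ (Equivalence.from (proj₂ (proj₂ meet₂) v₂) refl)

    p₀≡pₖ : k ≡ 0 → p zero ≡ p (fromℕ k)
    p₀≡pₖ k≡0 = cong p (sym (fromℕ≡zero k≡0))

  shared⇒k≡0 : ∀ {x} → InC4 c₁ x → InC4 c₂ x → k ≡ 0
  shared⇒k≡0 x∈c₁ x∈c₂ with k ≟ℕ 0
  ... | yes k≡0 = k≡0
  ... | no  k≢0 = ⊥-elim (disjoint (n≢0⇒n>0 k≢0) _ x∈c₁ x∈c₂)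

  same-end⇒k≡0 : v₁ ≡ v₂ → k ≡ 0
  same-end⇒k≡0 v₁≡v₂ = shared⇒k≡0 v₁∈c₁ (subst (InC4 c₂) (sym v₁≡v₂) v₂∈c₂)

  ends : (v₁ ≡ p zero × v₂ ≡ p (fromℕ k)) ⊎ (v₁ ≡ p (fromℕ k) × v₂ ≡ p zero)
  ends with proj₁ (proj₂ meet₁) | proj₁ (proj₂ meet₂)
  ... | inj₁ e₁ | inj₂ e₂ = inj₁ (e₁ , e₂)
  ... | inj₂ e₁ | inj₁ e₂ = inj₂ (e₁ , e₂)
  ... | inj₁ e₁ | inj₁ e₂ = inj₁ (e₁ , trans e₂ (p₀≡pₖ (same-end⇒k≡0 (trans e₁ (sym e₂)))))
  ... | inj₂ e₁ | inj₂ e₂ = inj₁ (trans e₁ (sym (p₀≡pₖ (same-end⇒k≡0 (trans e₁ (sym e₂))))) , e₂)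

  orient-at : v₁ ≡ p zero → v₂ ≡ p (fromℕ k) → ∃₂ (OrientedDumbbell G k)
  orient-at e₁ e₂ = proj₁ v₁∈c₁ , proj₁ v₂∈c₂ , record
    { a = c₁ ; b = c₂ ; p = p
    ; a-inj = c₁-inj ; b-inj = c₂-inj ; p-inj = p-inj
    ; a-sub = c₁-sub ; b-sub = c₂-sub ; p-sub = p-sub
    ; vert-union = vert-union
    ; a-anchor = trans (proj₂ v₁∈c₁) e₁
    ; b-anchor = trans (proj₂ v₂∈c₂) e₂
    ; a∩p = λ x x∈c₁ x∈p → trans (Equivalence.to (proj₂ (proj₂ meet₁) x) (x∈c₁ , x∈p)) e₁
    ; b∩p = λ x x∈c₂ x∈p → trans (Equivalence.to (proj₂ (proj₂ meet₂) x) (x∈c₂ , x∈p)) e₂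
    ; a∩b = λ x x∈c₁ x∈c₂ → common≤1 x (p zero) x∈c₁ x∈c₂ (subst (InC4 c₁) e₁ v₁∈c₁)
              (subst (InC4 c₂) (trans e₂ (sym (p₀≡pₖ (shared⇒k≡0 x∈c₁ x∈c₂)))) v₂∈c₂)
    }

orient : ∀ {n} {G : Graph n} (D : C4C4Dumbbell G) → ∃₂ (OrientedDumbbell G (C4C4Dumbbell.k D))
orient D with ends D
... | inj₁ (e₁ , e₂) = orient-at D e₁ e₂
... | inj₂ (e₁ , e₂) = orient-at (swap D) e₂ e₁

triple : Fin 7 → Fin 7 → Fin 7 → Subset 7
triple x y z = ⁅ x ⁆ ∪ ⁅ y ⁆ ∪ ⁅ z ⁆

-- Vertex 0 is the anchor, whose closed neighbourhood is completed outside the cycle.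
record CycleTable : Set where
  field
    entry           : Fin 4 → Subset 7
    entry-size      : ∀ j → ∣ entry j ∣ ≡ 3
    off-anchor-full : ∀ (j : Fin 3) →
      ⋃ (entry (suc j) ∷ entry (next4 (suc j)) ∷ entry (prev4 (suc j)) ∷ []) ≡ ⊤
open CycleTable

table : Subset 7 → Subset 7 → Subset 7 → Subset 7 → Fin 4 → Subset 7
table S₀ S₁ S₂ S₃ = lookup (S₀ ∷ S₁ ∷ S₂ ∷ S₃ ∷ [])

firstRow : Subset 7
firstRow = triple (# 0) (# 1) (# 2)

startTable : CycleTable
startTable = record
  { entry           = table firstRow (triple (# 0) (# 1) (# 6)) (triple (# 3) (# 4) (# 5))
                                     (triple (# 2) (# 3) (# 6))
  ; entry-size      = λ { zero → refl ; (suc zero) → refl ; (suc (suc zero)) → refl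
                        ; (suc (suc (suc zero))) → refl }
  ; off-anchor-full = λ { zero → refl ; (suc zero) → refl ; (suc (suc zero)) → refl }
  }

finishTable : CycleTable
finishTable = record
  { entry           = table firstRow (triple (# 1) (# 2) (# 3)) (triple (# 4) (# 5) (# 6))
                                     (triple (# 0) (# 3) (# 6))
  ; entry-size      = λ { zero → refl ; (suc zero) → refl ; (suc (suc zero)) → refl
                        ; (suc (suc (suc zero))) → refl }
  ; off-anchor-full = λ { zero → refl ; (suc zero) → refl ; (suc (suc zero)) → refl }
  }

bowtieTable : CycleTable
bowtieTable = record
  { entry           = table firstRow (triple (# 1) (# 4) (# 5)) (triple (# 0) (# 3) (# 6))
                                     (triple (# 2) (# 4) (# 5))
  ; entry-size      = λ { zero → refl ; (suc zero) → refl ; (suc (suc zero)) → refl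
                        ; (suc (suc (suc zero))) → refl }
  ; off-anchor-full = λ { zero → refl ; (suc zero) → refl ; (suc (suc zero)) → refl }
  }

rotateTable : ℕ → CycleTable → CycleTable
rotateTable r T = record
  { entry           = rotate^ r ∘ entry T
  ; entry-size      = λ j → trans (∣rotate^∣ r (entry T j)) (entry-size T j)
  ; off-anchor-full = λ j → rotate^-full r
      (entry T (suc j) ∷ entry T (next4 (suc j)) ∷ entry T (prev4 (suc j)) ∷ []) (off-anchor-full T j)
  }

pathRow : ℕ → Subset 7
pathRow t = rotate^ (t * 3) firstRow

pathRow-full : ∀ t → ⋃ (pathRow (suc t) ∷ pathRow t ∷ pathRow (suc (suc t)) ∷ []) ≡ ⊤
pathRow-full t = rotate^-full (t * 3) (rotate^ 3 firstRow ∷ firstRow ∷ rotate^ 6 firstRow ∷ []) refl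

endTable : ℕ → CycleTable
endTable zero    = bowtieTable
endTable (suc m) = rotateTable (suc m * 3) finishTable

endTable-anchor : ∀ k → entry (endTable k) zero ≡ pathRow k
endTable-anchor zero    = refl
endTable-anchor (suc m) = refl

end-anchor-full : ∀ m →
  ⋃ (entry (endTable (suc m)) zero ∷ entry (endTable (suc m)) (suc zero) ∷
     entry (endTable (suc m)) (prev4 zero) ∷ pathRow (toℕ (inject₁ (fromℕ m))) ∷ []) ≡ ⊤
end-anchor-full m rewrite toℕ-inject₁ (fromℕ m) | toℕ-fromℕ m = rotate^-full (m * 3)
  (rotate^ 3 (entry finishTable zero) ∷ rotate^ 3 (entry finishTable (suc zero)) ∷
   rotate^ 3 (entry finishTable (prev4 zero)) ∷ firstRow ∷ [])
  refl

path-interior-full : ∀ {m} (j : Fin m) →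
  ⋃ (pathRow (toℕ (suc (inject₁ j))) ∷ pathRow (toℕ (inject₁ (inject₁ j))) ∷
     pathRow (toℕ (suc (suc j))) ∷ []) ≡ ⊤
path-interior-full j rewrite toℕ-inject₁ (inject₁ j) | toℕ-inject₁ j = pathRow-full (toℕ j)

data LastOrInject₁ : ∀ {m} → Fin (suc m) → Set where
  is-last    : ∀ {m} → LastOrInject₁ (fromℕ m)
  is-inject₁ : ∀ {m} (j : Fin m) → LastOrInject₁ (inject₁ j)

last-or-inject₁ : ∀ {m} (i : Fin (suc m)) → LastOrInject₁ i
last-or-inject₁ {zero}  zero    = is-last
last-or-inject₁ {suc m} zero    = is-inject₁ zero
last-or-inject₁ {suc m} (suc i) with last-or-inject₁ i
... | is-last      = is-last
... | is-inject₁ j = is-inject₁ (suc j)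

data Loc (k : ℕ) : Set where
  onA onB : Fin 4 → Loc k
  onP     : Fin (suc k) → Loc k

module Labelling {n} {G : Graph n} {k} (D : OrientedDumbbell G k zero zero) where
  open OrientedDumbbell D

  at : Loc k → Fin n
  at (onA j) = a j
  at (onB j) = b j
  at (onP i) = p i

  row : Loc k → Subset 7
  row (onA j) = entry startTable j
  row (onB j) = entry (endTable k) j
  row (onP i) = pathRow (toℕ i)

  locate : ∀ x → ∃ λ ℓ → at ℓ ≡ x
  locate x with vert-union x
  ... | inj₁ (j , e)        = onA j , e
  ... | inj₂ (inj₁ (j , e)) = onB j , e
  ... | inj₂ (inj₂ (i , e)) = onP i , e

  a-meets-p : ∀ {j i} → a j ≡ p i → j ≡ zero × i ≡ zero
  a-meets-p {j} {i} e = a-inj (trans aj≡p₀ (sym a-anchor)) , p-inj (trans (sym e) aj≡p₀)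
    where aj≡p₀ = a∩p (a j) (j , refl) (i , sym e)

  b-meets-p : ∀ {j i} → b j ≡ p i → j ≡ zero × i ≡ fromℕ k
  b-meets-p {j} {i} e = b-inj (trans bj≡pₖ (sym b-anchor)) , p-inj (trans (sym e) bj≡pₖ)
    where bj≡pₖ = b∩p (b j) (j , refl) (i , sym e)

  a-meets-b : ∀ {j j′} → a j ≡ b j′ → j ≡ zero × j′ ≡ zero × k ≡ 0
  a-meets-b {j} {j′} e =
    proj₁ (a-meets-p aj≡p₀) , proj₁ (b-meets-p bj′≡p₀) ,
    trans (sym (toℕ-fromℕ k)) (cong toℕ (sym (proj₂ (b-meets-p bj′≡p₀))))
    where
    aj≡p₀ : a j ≡ p zero
    aj≡p₀ = a∩b (a j) (j , refl) (j′ , sym e)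
    bj′≡p₀ : b j′ ≡ p zero
    bj′≡p₀ = trans (sym e) aj≡p₀

  a-p-rows : ∀ {j i} → a j ≡ p i → entry startTable j ≡ pathRow (toℕ i)
  a-p-rows e with a-meets-p e
  ... | refl , refl = refl

  b-p-rows : ∀ {j i} → b j ≡ p i → entry (endTable k) j ≡ pathRow (toℕ i)
  b-p-rows e with b-meets-p e
  ... | refl , refl = trans (endTable-anchor k) (cong pathRow (sym (toℕ-fromℕ k)))

  a-b-rows : ∀ {j j′} → a j ≡ b j′ → entry startTable j ≡ entry (endTable k) j′
  a-b-rows e with a-meets-b e
  ... | refl , refl , k≡0 = sym (trans (endTable-anchor k) (cong pathRow k≡0))

  row-wd : ∀ ℓ ℓ′ → at ℓ ≡ at ℓ′ → row ℓ ≡ row ℓ′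
  row-wd (onA j) (onA j′) e = cong (entry startTable) (a-inj e)
  row-wd (onA j) (onB j′) e = a-b-rows e
  row-wd (onA j) (onP i)  e = a-p-rows e
  row-wd (onB j) (onA j′) e = sym (a-b-rows (sym e))
  row-wd (onB j) (onB j′) e = cong (entry (endTable k)) (b-inj e)
  row-wd (onB j) (onP i)  e = b-p-rows e
  row-wd (onP i) (onA j)  e = sym (a-p-rows (sym e))
  row-wd (onP i) (onB j)  e = sym (b-p-rows (sym e))
  row-wd (onP i) (onP i′) e = cong (pathRow ∘ toℕ) (p-inj e)

  open Located G at row locate row-wd public

  row-size : ∀ ℓ → ∣ row ℓ ∣ ≤ 3
  row-size (onA j) = ≤-reflexive (entry-size startTable j)
  row-size (onB j) = ≤-reflexive (entry-size (endTable k) j)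
  row-size (onP i) = ≤-reflexive (∣rotate^∣ (toℕ i * 3) firstRow)

  a-off-anchor-full : ∀ j → FullNbhd G colour (a (suc j))
  a-off-anchor-full j = full-at (onA (suc j)) (onA (next4 (suc j)) ∷ onA (prev4 (suc j)) ∷ [])
    (a-sub (suc j) ∷ sub-prev G a-sub (suc j) ∷ []) (off-anchor-full startTable j)

  b-off-anchor-full : ∀ j → FullNbhd G colour (b (suc j))
  b-off-anchor-full j = full-at (onB (suc j)) (onB (next4 (suc j)) ∷ onB (prev4 (suc j)) ∷ [])
    (b-sub (suc j) ∷ sub-prev G b-sub (suc j) ∷ []) (off-anchor-full (endTable k) j)

module _ {n} {G : Graph n} where

  a-anchor-full : ∀ {k} (D : OrientedDumbbell G k zero zero) →
                  FullNbhd G (Labelling.colour D) (OrientedDumbbell.a D zero)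
  a-anchor-full {zero} D = full-at (onA zero)
    (onA (suc zero) ∷ onA (prev4 zero) ∷ onB (suc zero) ∷ onB (prev4 zero) ∷ [])
    (a-sub zero ∷ sub-prev G a-sub zero ∷ via-b (b-sub zero) ∷ via-b (sub-prev G b-sub zero) ∷ [])
    refl
    where
    open OrientedDumbbell D
    open Labelling D
    via-b : ∀ {x} → Adj G (b zero) x → Adj G (a zero) x
    via-b = subst (λ y → Adj G y _) (trans b-anchor (sym a-anchor))
  a-anchor-full {suc m} D = full-at (onA zero)
    (onA (suc zero) ∷ onA (prev4 zero) ∷ onP (suc zero) ∷ [])
    (a-sub zero ∷ sub-prev G a-sub zero ∷
     subst (λ y → Adj G y (p (suc zero))) (sym a-anchor) (p-sub zero) ∷ [])
    refl
    where
    open OrientedDumbbell D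
    open Labelling D

  b-anchor-full : ∀ {k} (D : OrientedDumbbell G k zero zero) →
                  FullNbhd G (Labelling.colour D) (OrientedDumbbell.b D zero)
  b-anchor-full {zero} D = subst (FullNbhd G colour) (trans a-anchor (sym b-anchor)) (a-anchor-full D)
    where
    open OrientedDumbbell D
    open Labelling D
  b-anchor-full {suc m} D = full-at (onB zero)
    (onB (suc zero) ∷ onB (prev4 zero) ∷ onP (inject₁ (fromℕ m)) ∷ [])
    (b-sub zero ∷ sub-prev G b-sub zero ∷
     subst (λ y → Adj G y (p (inject₁ (fromℕ m)))) (sym b-anchor) (Adj-sym G (p-sub (fromℕ m))) ∷ [])
    (end-anchor-full m)
    where
    open OrientedDumbbell D
    open Labelling D

  p-full : ∀ {k} (D : OrientedDumbbell G k zero zero) i →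
           FullNbhd G (Labelling.colour D) (OrientedDumbbell.p D i)
  p-full D zero = subst (FullNbhd G colour) a-anchor (a-anchor-full D)
    where
    open OrientedDumbbell D
    open Labelling D
  p-full {suc m} D (suc i) with last-or-inject₁ i
  ... | is-last = subst (FullNbhd G colour) b-anchor (b-anchor-full D)
    where
    open OrientedDumbbell D
    open Labelling D
  ... | is-inject₁ j = full-at (onP (suc (inject₁ j)))
    (onP (inject₁ (inject₁ j)) ∷ onP (suc (suc j)) ∷ [])
    (Adj-sym G (p-sub (inject₁ j)) ∷ p-sub (suc j) ∷ [])
    (path-interior-full j)
    where
    open OrientedDumbbell D
    open Labelling D

  oriented-configuration : ∀ {k} → OrientedDumbbell G k zero zero → Configuration G 7 3
  oriented-configuration D = configuration row-size full
    where
    open Labelling D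
    full : ∀ ℓ → FullNbhd G colour (at ℓ)
    full (onA zero)    = a-anchor-full D
    full (onA (suc j)) = a-off-anchor-full j
    full (onB zero)    = b-anchor-full D
    full (onB (suc j)) = b-off-anchor-full j
    full (onP i)       = p-full D i

lemma11 : ∀ {n} (G : Graph n) → C4C4Dumbbell G → Configuration G 7 3
lemma11 G D with orient D
... | _ , _ , D′ = oriented-configuration (reorient D′)
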